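{- Let $a,b,c,d$ be nonnegative integers with $a+b=c+d>0$. The Simple Chopsticks position $[1^a,2^b]\,[1^c,2^d]_2$ has outcome (i) $\mathcal{P}$ if $b=d=0$ and $a$ and $c$ are odd; (ii) $\mathcal{L}$ if $b=0$, $d\neq 0$ and $c$ is odd; (iii) $\mathcal{R}$ if $d=0$, $b\neq 0$ and $a$ is odd; (iv) $\mathcal{N}$ in all other cases.
   Context: Simple Chopsticks. Fix a positive integer $n$, the finger count. A position $[x_1,\ldots,x_\ell]\,[y_1,\ldots,y_r]_n$ consists of a finite non-decreasing sequence of integers in $\{1,\ldots,n\}$ for Left (her hands) and one for Right; either list may be empty. Left's moves: for any $i,j$, replace $y_j$ by $y_j+x_i$, removing the entry from Right's list if $y_j+x_i>n$. Right's moves: for any $i,j$, replace $x_i$ by $x_i+y_j$, removing it if $x_i+y_j>n$. No moves exist when either list is empty. Normal play: a player unable to move loses. Notation: $k^a$ denotes $k$ repeated $a$ times, so $[1^a,2^b]\,[1^c,2^d]_2$ means finger count $2$, Left has $a$ hands with one finger and $b$ with two, Right has $c$ with one and $d$ with two. Outcomes: $\mathcal{N}$ = first player wins, $\mathcal{P}$ = second player wins, $\mathcal{L}$ = Left wins whoever starts, $\mathcal{R}$ = Right wins whoever starts. -}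

module Defs where

open import Data.Nat using (ℕ; _+_; _<ᵇ_; _%_)
open import Data.Bool using (if_then_else_)
open import Data.List using (List; length; lookup; updateAt; removeAt; replicate; _++_)
open import Data.Fin using (Fin)
open import Data.Product using (_×_)
open import Relation.Binary.PropositionalEquality using (_≡_)

-- Hands are kept as lists; the paper's non-decreasing ordering is irrelevant to play
-- (a position is really a multiset of hands).

hit : ℕ → ℕ → (ys : List ℕ) → Fin (length ys) → List ℕ
hit n x ys j = if n <ᵇ (lookup ys j + x) then removeAt ys j else updateAt ys j (_+ x)

-- Normal-play winning predicates (the game is finite, so inductive definitions suffice).
-- LeftWinsMoving n xs ys   : Left is to move in [xs][ys]_n and Left has a winning strategy.
-- LeftWinsWaiting n xs ys  : Right is to move in [xs][ys]_n and Left has a winning strategy.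
mutual
  data LeftWinsMoving (n : ℕ) (xs ys : List ℕ) : Set where
    lmove : (i : Fin (length xs)) (j : Fin (length ys)) →
            LeftWinsWaiting n xs (hit n (lookup xs i) ys j) →
            LeftWinsMoving n xs ys

  data LeftWinsWaiting (n : ℕ) (xs ys : List ℕ) : Set where
    lwait : ((j : Fin (length ys)) (i : Fin (length xs)) →
             LeftWinsMoving n (hit n (lookup ys j) xs i) ys) →
            LeftWinsWaiting n xs ys

-- RightWinsMoving n xs ys  : Right is to move and Right has a winning strategy.
-- RightWinsWaiting n xs ys : Left is to move and Right has a winning strategy.
mutual
  data RightWinsMoving (n : ℕ) (xs ys : List ℕ) : Set where
    rmove : (j : Fin (length ys)) (i : Fin (length xs)) →
            RightWinsWaiting n (hit n (lookup ys j) xs i) ys →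
            RightWinsMoving n xs ys

  data RightWinsWaiting (n : ℕ) (xs ys : List ℕ) : Set where
    rwait : ((i : Fin (length xs)) (j : Fin (length ys)) →
             RightWinsMoving n xs (hit n (lookup xs i) ys j)) →
            RightWinsWaiting n xs ys

data Outcome : Set where
  𝒩 𝒫 𝓛 𝓡 : Outcome

HasOutcome : ℕ → List ℕ → List ℕ → Outcome → Set
HasOutcome n xs ys 𝒩 = LeftWinsMoving n xs ys × RightWinsMoving n xs ys
HasOutcome n xs ys 𝒫 = RightWinsWaiting n xs ys × LeftWinsWaiting n xs ys
HasOutcome n xs ys 𝓛 = LeftWinsMoving n xs ys × LeftWinsWaiting n xs ys
HasOutcome n xs ys 𝓡 = RightWinsMoving n xs ys × RightWinsWaiting n xs ys

_^^_ : ℕ → ℕ → List ℕ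
k ^^ a = replicate a k

Odd : ℕ → Set
Odd a = a % 2 ≡ 1

module Submission where

-- With two fingers a position is determined by how many one- and two-finger
-- hands each player has, and a strike either turns a 1 into a 2 (1 on 1) or
-- kills the hand that is hit. Write (a , b) for the hands of the player to move
-- and (c , d) for the opponent's. The player to move wins exactly when
--   c ≥ 1 and c + a mod 2 ≤ a + b          if d = 0,
--   c + d ≤ a + c mod 2                    if d > 0 and b = 0,
--   c + d ≤ a + b                          if d > 0 and b > 0.
-- This is checked by induction on the opponent's weight 2c + d, which every
-- strike decreases: from a position satisfying the condition some strike leaves
-- the opponent in a position violating it, and every strike from a position
-- violating it leaves the opponent in one satisfying it. When a + b = c + d the
-- four outcomes are read off by evaluating the condition in both directions.

open import Defs
open import Data.Bool.Properties using (if-float)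
open import Data.Nat using (ℕ; zero; suc; _+_; _%_; _≤_; _<_; _≤?_; _<ᵇ_; z≤n; s≤s)
open import Data.Nat.Properties
open import Data.Nat.DivMod using (m%n<n; m%n≤m)
open import Data.Nat.Induction using (<-wellFounded)
open import Data.Fin using (Fin; zero; suc)
open import Data.List using (List; _∷_; _++_; foldr; length; lookup)
open import Data.List.Relation.Unary.All using (All; []; _∷_)
open import Data.List.Relation.Unary.All.Properties using (++⁺; replicate⁺)
open import Data.Product using (_×_; _,_; proj₂; Σ-syntax)
open import Data.Sum using (_⊎_; inj₁; inj₂)
open import Data.Empty using (⊥; ⊥-elim)
open import Function using (_∘_)
open import Induction.WellFounded using (Acc; acc)
open import Relation.Nullary using (¬_; Dec; decidable-stable; contradiction)
open import Relation.Nullary.Decidable using (_×-dec_)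
open import Relation.Binary.PropositionalEquality

variable
  a b c d m n o x y : ℕ
  xs ys : List ℕ

%2≤1 : ∀ n → n % 2 ≤ 1
%2≤1 n = ≤-pred (m%n<n n 2)

%2-suc : ∀ n → suc n % 2 + n % 2 ≡ 1
%2-suc zero          = refl
%2-suc (suc zero)    = refl
%2-suc (suc (suc n)) = %2-suc n

+-%2-suc : ∀ m n → m + suc n % 2 + n % 2 ≡ m + 1
+-%2-suc m n = trans (+-assoc m _ _) (cong (m +_) (%2-suc n))

¬odd⇒even : ∀ n → ¬ Odd n → n % 2 ≡ 0
¬odd⇒even n ¬odd with m≤n⇒m<n∨m≡n (%2≤1 n)
... | inj₁ n%2<1 = n<1⇒n≡0 n%2<1
... | inj₂ n%2≡1 = contradiction n%2≡1 ¬odd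

-- Both bounds force n = 1 + c, and then they add up to 1 + c + 1 ≤ 1 + c.
parity-clash : suc c + n % 2 ≤ n → n + c % 2 ≤ suc c → ⊥
parity-clash {c} {n} h h′ with ≤-antisym (m+n≤o⇒m≤o n h′) (m+n≤o⇒m≤o (suc c) h)
... | refl = m+1+n≰m (suc c)
  (subst (_≤ suc c) (+-%2-suc (suc c) c) (≤-trans (+-monoˡ-≤ (c % 2) h) h′))

parity-step : c + 1 ≤ n + c % 2 → c + suc n % 2 ≤ n
parity-step {c} {n} h with m≤n⇒m<n∨m≡n (+-cancelʳ-≤ 1 c n (≤-trans h (+-monoʳ-≤ n (%2≤1 c))))
... | inj₁ c<n  = ≤-trans (+-monoʳ-≤ c (%2≤1 (suc n))) (subst (_≤ n) (+-comm 1 c) c<n)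
... | inj₂ refl = +-cancelʳ-≤ (c % 2) _ _ (subst (_≤ c + c % 2) (sym (+-%2-suc c c)) h)

suc-+≤⇒+-suc≤ : suc (m + n) ≤ o → m + suc n ≤ o
suc-+≤⇒+-suc≤ {m} {n} {o} = subst (_≤ o) (sym (+-suc m n))

-- (number of one-finger hands , number of two-finger hands) of a player.
Hands : Set
Hands = ℕ × ℕ

NextWins : Hands → Hands → Set
NextWins (a , b)     (c , zero)  = 1 ≤ c × c + a % 2 ≤ a + b
NextWins (a , zero)  (c , suc d) = c + suc d ≤ a + c % 2
NextWins (a , suc b) (c , suc d) = c + suc d ≤ a + suc b

nextWins? : ∀ p q → Dec (NextWins p q)
nextWins? (a , b)     (c , zero)  = (1 ≤? c) ×-dec (c + a % 2 ≤? a + b)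
nextWins? (a , zero)  (c , suc d) = c + suc d ≤? a + c % 2
nextWins? (a , suc b) (c , suc d) = c + suc d ≤? a + suc b

data Holds : ℕ → Hands → Set where
  holds-one : Holds 1 (suc a , b)
  holds-two : Holds 2 (a , suc b)

-- Strike x y q q′: a hand with x fingers hits one with y fingers of a player
-- holding q, who is left with q′.
data Strike : ℕ → ℕ → Hands → Hands → Set where
  one-one : Strike 1 1 (suc c , d) (c , suc d)
  two-one : Strike 2 1 (suc c , d) (c , d)
  one-two : Strike 1 2 (c , suc d) (c , d)
  two-two : Strike 2 2 (c , suc d) (c , d)

data Move (p q q′ : Hands) : Set where
  move : Holds x p → Strike x y q q′ → Move p q q′

nextWins⇒move : ∀ {p q} → NextWins p q → Σ[ q′ ∈ Hands ] Move p q q′ × ¬ NextWins q′ p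
nextWins⇒move {q = zero , zero}                   (() , _)
nextWins⇒move {a , suc b}    {suc c , zero}       (_ , h) =
  (c , 0) , move holds-two two-one , <⇒≱ h
nextWins⇒move {zero , zero}  {suc c , zero}       (_ , ())
nextWins⇒move {suc a , zero} {suc c , zero}       (_ , h) =
  (c , 1) , move holds-one one-one ,
  λ (_ , h′) → parity-clash (subst (suc c + suc a % 2 ≤_) (+-identityʳ (suc a)) h)
                            (subst (suc a + c % 2 ≤_) (+-comm c 1) h′)
nextWins⇒move {zero , zero}  {c , suc d}          h =
  ⊥-elim (m+1+n≰m c (≤-trans h (m%n≤m c 2)))
nextWins⇒move {suc a , zero} {c , suc d}          h =
  (c , d) , move holds-one one-two ,
  λ (_ , h′) → <⇒≱ (subst (_≤ suc a + c % 2) (+-suc c d) h) h′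
nextWins⇒move {a , suc b}    {suc c , suc d}      h =
  (c , suc d) , move holds-two two-one , <⇒≱ h
nextWins⇒move {a , suc b}    {zero , suc zero}    h =
  (0 , 0) , move holds-two two-two , λ h′ → m+1+n≰m a (≤-trans h′ (m%n≤m a 2))
nextWins⇒move {a , suc b}    {zero , suc (suc d)} h =
  (0 , suc d) , move holds-two two-two , <⇒≱ h

two-strikes-two⇒nextWins : ¬ NextWins (c , d) (a , suc b) → NextWins (a , suc b) (c , suc d)
two-strikes-two⇒nextWins {c} {zero}  nh = ≤-trans (+-monoʳ-≤ c (s≤s z≤n)) (suc-+≤⇒+-suc≤ (≰⇒> nh))
two-strikes-two⇒nextWins {c} {suc d} nh = suc-+≤⇒+-suc≤ (≰⇒> nh)

move⇒nextWins : ∀ {p q q′} → Move p q q′ → ¬ NextWins q′ p → NextWins p q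
move⇒nextWins {suc a , zero} {suc c , zero} (move holds-one one-one) nh =
  s≤s z≤n , subst (suc c + suc a % 2 ≤_) (sym (+-identityʳ (suc a)))
                  (s≤s (parity-step (≤-pred (≰⇒> (nh ∘ (s≤s z≤n ,_))))))
move⇒nextWins {suc a , zero} {suc c , suc d} (move holds-one one-one) nh = begin
  suc c + suc d      ≡⟨ sym (+-suc c (suc d)) ⟩
  c + suc (suc d)    ≤⟨ ≤-pred (≤-trans (≰⇒> (nh ∘ (s≤s z≤n ,_)))
                               (≤-trans (+-monoʳ-≤ (suc a) (%2≤1 c)) (≤-reflexive (+-comm (suc a) 1)))) ⟩
  suc a              ≤⟨ m≤m+n (suc a) _ ⟩
  suc a + suc c % 2  ∎
  where open ≤-Reasoning
move⇒nextWins {suc a , suc b} {suc c , zero} (move holds-one one-one) nh =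
  s≤s z≤n , ≤-trans (+-monoʳ-≤ (suc c) (%2≤1 (suc a))) (≰⇒> nh)
move⇒nextWins {suc a , suc b} {suc c , suc d} (move holds-one one-one) nh =
  ≤-trans (s≤s (+-monoʳ-≤ c (n≤1+n (suc d)))) (≰⇒> nh)
move⇒nextWins {a , suc b} {suc c , zero}  (move holds-two two-one) nh = s≤s z≤n , ≰⇒> nh
move⇒nextWins {a , suc b} {suc c , suc d} (move holds-two two-one) nh = ≰⇒> nh
move⇒nextWins (move holds-two two-two) nh = two-strikes-two⇒nextWins nh
move⇒nextWins {suc a , suc b} (move holds-one one-two) nh = two-strikes-two⇒nextWins nh
move⇒nextWins {suc a , zero} {c , suc zero}    (move holds-one one-two) nh =
  suc-+≤⇒+-suc≤ (≰⇒> (nh ∘ (s≤s z≤n ,_)))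
move⇒nextWins {suc a , zero} {c , suc (suc d)} (move holds-one one-two) nh =
  suc-+≤⇒+-suc≤ (≰⇒> (nh ∘ (s≤s z≤n ,_)))

weight : Hands → ℕ
weight (c , d) = c + (c + d)

strike-shrinks : ∀ {q q′} → Strike x y q q′ → weight q′ < weight q
strike-shrinks {q = suc c , d} one-one = s≤s (≤-reflexive (cong (c +_) (+-suc c d)))
strike-shrinks {q = suc c , d} two-one = s≤s (+-monoʳ-≤ c (n≤1+n (c + d)))
strike-shrinks {q = c , suc d} one-two = +-monoʳ-< c (+-monoʳ-< c (n<1+n d))
strike-shrinks {q = c , suc d} two-two = +-monoʳ-< c (+-monoʳ-< c (n<1+n d))

move-shrinks : ∀ {p q q′} → Move p q q′ → weight q′ + weight p < weight p + weight q
move-shrinks {p} {q} {q′} (move _ s) =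
  subst (_< weight p + weight q) (+-comm (weight p) (weight q′)) (+-monoʳ-< (weight p) (strike-shrinks s))

data Hand : ℕ → Set where
  one : Hand 1
  two : Hand 2

-- Only entries 1 and 2 are counted; all lists below satisfy All Hand.
add : ℕ → Hands → Hands
add 1 (a , b) = suc a , b
add 2 (a , b) = a , suc b
add _ p       = p

count : List ℕ → Hands
count = foldr add (0 , 0)

holds-hand : ∀ {p} → Holds x p → Hand x
holds-hand holds-one = one
holds-hand holds-two = two

holds-add : ∀ {p} → Hand y → Holds x p → Holds x (add y p)
holds-add one holds-one = holds-one
holds-add one holds-two = holds-two
holds-add two holds-one = holds-one
holds-add two holds-two = holds-two

holds-add⁻¹ : ∀ {p} → Hand y → Holds x (add y p) → x ≡ y ⊎ Holds x p
holds-add⁻¹ one holds-one = inj₁ refl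
holds-add⁻¹ one holds-two = inj₂ holds-two
holds-add⁻¹ two holds-one = inj₂ holds-one
holds-add⁻¹ two holds-two = inj₁ refl

holds-lookup : All Hand xs → (i : Fin (length xs)) → Holds (lookup xs i) (count xs)
holds-lookup (one ∷ _)  zero    = holds-one
holds-lookup (two ∷ _)  zero    = holds-two
holds-lookup (h ∷ hs)   (suc i) = holds-add h (holds-lookup hs i)

holds-find : All Hand xs → Holds x (count xs) → Σ[ i ∈ Fin (length xs) ] lookup xs i ≡ x
holds-find []       ()
holds-find (h ∷ hs) hx with holds-add⁻¹ h hx
... | inj₁ refl = zero , refl
... | inj₂ hx′  = let i , e = holds-find hs hx′ in suc i , e

strike-target : ∀ {q q′} → Strike x y q q′ → Holds y q
strike-target one-one = holds-one
strike-target two-one = holds-one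
strike-target one-two = holds-two
strike-target two-two = holds-two

strike-unique : ∀ {q q₁ q₂} → Strike x y q q₁ → Strike x y q q₂ → q₁ ≡ q₂
strike-unique one-one one-one = refl
strike-unique two-one two-one = refl
strike-unique one-two one-two = refl
strike-unique two-two two-two = refl

strike-add : ∀ {q q′} → Hand m → Strike x y q q′ → Strike x y (add m q) (add m q′)
strike-add one one-one = one-one
strike-add one two-one = two-one
strike-add one one-two = one-two
strike-add one two-two = two-two
strike-add two one-one = one-one
strike-add two two-one = two-one
strike-add two one-two = one-two
strike-add two two-two = two-two

hit-suc : ∀ {j} → hit n x (y ∷ ys) (suc j) ≡ y ∷ hit n x ys j
hit-suc {n} {x} {y} {ys} {j} = sym (if-float (y ∷_) (n <ᵇ (lookup ys j + x)))

strike-hit : Hand x → All Hand ys → (j : Fin (length ys)) →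
             All Hand (hit 2 x ys j) × Strike x (lookup ys j) (count ys) (count (hit 2 x ys j))
strike-hit one (one ∷ hs) zero = two ∷ hs , one-one
strike-hit two (one ∷ hs) zero = hs , two-one
strike-hit one (two ∷ hs) zero = hs , one-two
strike-hit two (two ∷ hs) zero = hs , two-two
strike-hit {x} {y ∷ ys} hx (h ∷ hs) (suc j) rewrite hit-suc {2} {x} {y} {ys} {j} =
  let hs′ , s = strike-hit hx hs j in h ∷ hs′ , strike-add h s

hit-move : All Hand xs → All Hand ys → (i : Fin (length xs)) (j : Fin (length ys)) →
           All Hand (hit 2 (lookup xs i) ys j) × Move (count xs) (count ys) (count (hit 2 (lookup xs i) ys j))
hit-move hxs hys i j =
  let hx        = holds-lookup hxs i
      hys′ , s  = strike-hit (holds-hand hx) hys j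
  in hys′ , move hx s

move-hit : ∀ {q′} → All Hand xs → All Hand ys → Move (count xs) (count ys) q′ →
           Σ[ i ∈ Fin (length xs) ] Σ[ j ∈ Fin (length ys) ] count (hit 2 (lookup xs i) ys j) ≡ q′
move-hit hxs hys (move hx s) with holds-find hxs hx | holds-find hys (strike-target s)
... | i , refl | j , refl = i , j , strike-unique (proj₂ (strike-hit (holds-hand hx) hys j)) s

mutual
  mirrorRW : RightWinsWaiting n xs ys → LeftWinsWaiting n ys xs
  mirrorRW (rwait f) = lwait λ i j → mirrorRM (f i j)

  mirrorRM : RightWinsMoving n xs ys → LeftWinsMoving n ys xs
  mirrorRM (rmove j i w) = lmove j i (mirrorRW w)

mutual
  mirrorLW : LeftWinsWaiting n xs ys → RightWinsWaiting n ys xs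
  mirrorLW (lwait f) = rwait λ j i → mirrorLM (f j i)

  mirrorLM : LeftWinsMoving n xs ys → RightWinsMoving n ys xs
  mirrorLM (lmove i j w) = rmove i j (mirrorLW w)

size : List ℕ → List ℕ → ℕ
size xs ys = weight (count xs) + weight (count ys)

mutual
  nextWins⇒leftWinsMoving : All Hand xs → All Hand ys → Acc _<_ (size xs ys) →
                            NextWins (count xs) (count ys) → LeftWinsMoving 2 xs ys
  nextWins⇒leftWinsMoving hxs hys (acc rs) w with nextWins⇒move w
  ... | _ , m , l with move-hit hxs hys m
  ... | i , j , refl =
    let hys′ , _ = hit-move hxs hys i j
    in lmove i j (mirrorRW (¬nextWins⇒rightWinsWaiting hys′ hxs (rs (move-shrinks m)) l))

  ¬nextWins⇒rightWinsWaiting : All Hand xs → All Hand ys → Acc _<_ (size xs ys) →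
                               ¬ NextWins (count xs) (count ys) → RightWinsWaiting 2 xs ys
  ¬nextWins⇒rightWinsWaiting hxs hys (acc rs) l = rwait λ i j →
    let hys′ , m = hit-move hxs hys i j
        w        = decidable-stable (nextWins? _ _) (l ∘ move⇒nextWins m)
    in mirrorLM (nextWins⇒leftWinsMoving hys′ hxs (rs (move-shrinks m)) w)

hands : ℕ → ℕ → List ℕ
hands a b = (1 ^^ a) ++ (2 ^^ b)

count-hands : ∀ a b → count (hands a b) ≡ (a , b)
count-hands zero    zero    = refl
count-hands zero    (suc b) = cong (add 2) (count-hands zero b)
count-hands (suc a) b       = cong (add 1) (count-hands a b)

all-hands : ∀ a b → All Hand (hands a b)
all-hands a b = ++⁺ (replicate⁺ a one) (replicate⁺ b two)

hands-leftWinsMoving : NextWins (a , b) (c , d) → LeftWinsMoving 2 (hands a b) (hands c d)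
hands-leftWinsMoving {a} {b} {c} {d} w =
  nextWins⇒leftWinsMoving (all-hands a b) (all-hands c d) (<-wellFounded _)
    (subst₂ NextWins (sym (count-hands a b)) (sym (count-hands c d)) w)

hands-rightWinsWaiting : ¬ NextWins (a , b) (c , d) → RightWinsWaiting 2 (hands a b) (hands c d)
hands-rightWinsWaiting {a} {b} {c} {d} l =
  ¬nextWins⇒rightWinsWaiting (all-hands a b) (all-hands c d) (<-wellFounded _)
    (l ∘ subst₂ NextWins (count-hands a b) (count-hands c d))

hands-𝒩 : ∀ a b c d → NextWins (a , b) (c , d) → NextWins (c , d) (a , b) →
          HasOutcome 2 (hands a b) (hands c d) 𝒩
hands-𝒩 _ _ _ _ w w′ = hands-leftWinsMoving w , mirrorLM (hands-leftWinsMoving w′)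

hands-𝒫 : ∀ a b c d → ¬ NextWins (a , b) (c , d) → ¬ NextWins (c , d) (a , b) →
          HasOutcome 2 (hands a b) (hands c d) 𝒫
hands-𝒫 _ _ _ _ l l′ = hands-rightWinsWaiting l , mirrorRW (hands-rightWinsWaiting l′)

hands-𝓛 : ∀ a b c d → NextWins (a , b) (c , d) → ¬ NextWins (c , d) (a , b) →
          HasOutcome 2 (hands a b) (hands c d) 𝓛
hands-𝓛 _ _ _ _ w l′ = hands-leftWinsMoving w , mirrorRW (hands-rightWinsWaiting l′)

hands-𝓡 : ∀ a b c d → ¬ NextWins (a , b) (c , d) → NextWins (c , d) (a , b) →
          HasOutcome 2 (hands a b) (hands c d) 𝓡
hands-𝓡 _ _ _ _ l w′ = mirrorLM (hands-leftWinsMoving w′) , hands-rightWinsWaiting l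

ones-vs-ones-odd : Odd a → ¬ NextWins (a , 0) (a , 0)
ones-vs-ones-odd {a} odd (_ , h) = m+1+n≰m a (subst₂ (λ k l → a + k ≤ l) odd (+-identityʳ a) h)

ones-vs-ones-even : a % 2 ≡ 0 → 1 ≤ a → NextWins (a , 0) (a , 0)
ones-vs-ones-even {a} even 1≤a = 1≤a , ≤-reflexive (cong (a +_) even)

ones-vs-twos : a ≡ c + suc d → NextWins (a , 0) (c , suc d)
ones-vs-twos {a} {c} eq = ≤-trans (≤-reflexive (sym eq)) (m≤m+n a (c % 2))

twos-vs-ones-odd : Odd c → a ≡ c + suc d → ¬ NextWins (c , suc d) (a , 0)
twos-vs-ones-odd {a = a} odd eq (_ , h) = m+1+n≰m a (subst₂ (λ k l → a + k ≤ l) odd (sym eq) h)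

twos-vs-ones-even : c % 2 ≡ 0 → a ≡ c + suc d → NextWins (c , suc d) (a , 0)
twos-vs-ones-even {c} {a} {d} even eq =
  subst (1 ≤_) (sym (trans eq (+-suc c d))) (s≤s z≤n) ,
  ≤-reflexive (trans (cong (a +_) even) (trans (+-identityʳ a) eq))

twos-vs-twos : a + suc b ≡ c + suc d → NextWins (a , suc b) (c , suc d)
twos-vs-twos eq = ≤-reflexive (sym eq)

outcome-𝒫 : ∀ a b c d → a + b ≡ c + d → b ≡ 0 × d ≡ 0 × Odd a × Odd c →
            HasOutcome 2 (hands a b) (hands c d) 𝒫
outcome-𝒫 a .0 c .0 eq (refl , refl , odd-a , _) with +-cancelʳ-≡ 0 a c eq
... | refl = hands-𝒫 a 0 a 0 (ones-vs-ones-odd odd-a) (ones-vs-ones-odd odd-a)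

outcome-𝓛 : ∀ a b c d → a + b ≡ c + d → b ≡ 0 × d ≢ 0 × Odd c →
            HasOutcome 2 (hands a b) (hands c d) 𝓛
outcome-𝓛 a .0 c zero    eq (refl , d≢0 , _)   = contradiction refl d≢0
outcome-𝓛 a .0 c (suc d) eq (refl , _ , odd-c) =
  hands-𝓛 a 0 c (suc d) (ones-vs-twos eq′) (twos-vs-ones-odd odd-c eq′)
  where
  eq′ = trans (sym (+-identityʳ a)) eq

outcome-𝓡 : ∀ a b c d → a + b ≡ c + d → d ≡ 0 × b ≢ 0 × Odd a →
            HasOutcome 2 (hands a b) (hands c d) 𝓡
outcome-𝓡 a zero    c .0 eq (refl , b≢0 , _)   = contradiction refl b≢0
outcome-𝓡 a (suc b) c .0 eq (refl , _ , odd-a) =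
  hands-𝓡 a (suc b) c 0 (twos-vs-ones-odd odd-a eq′) (ones-vs-twos eq′)
  where
  eq′ = trans (sym (+-identityʳ c)) (sym eq)

outcome-𝒩 : ∀ a b c d → a + b ≡ c + d → 0 < a + b →
            ¬ (b ≡ 0 × d ≡ 0 × Odd a × Odd c) → ¬ (b ≡ 0 × d ≢ 0 × Odd c) → ¬ (d ≡ 0 × b ≢ 0 × Odd a) →
            HasOutcome 2 (hands a b) (hands c d) 𝒩
outcome-𝒩 a (suc b) c (suc d) eq _ _ _ _ =
  hands-𝒩 a (suc b) c (suc d) (twos-vs-twos eq) (twos-vs-twos (sym eq))
outcome-𝒩 a (suc b) c zero eq _ _ _ ¬𝓡 =
  hands-𝒩 a (suc b) c 0 (twos-vs-ones-even even-a eq′) (ones-vs-twos eq′)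
  where
  even-a = ¬odd⇒even a (λ odd-a → ¬𝓡 (refl , (λ ()) , odd-a))
  eq′    = trans (sym (+-identityʳ c)) (sym eq)
outcome-𝒩 a zero c (suc d) eq _ _ ¬𝓛 _ =
  hands-𝒩 a 0 c (suc d) (ones-vs-twos eq′) (twos-vs-ones-even even-c eq′)
  where
  even-c = ¬odd⇒even c (λ odd-c → ¬𝓛 (refl , (λ ()) , odd-c))
  eq′    = trans (sym (+-identityʳ a)) eq
outcome-𝒩 a zero c zero eq 0<a+0 ¬𝒫 _ _ with +-cancelʳ-≡ 0 a c eq
... | refl = hands-𝒩 a 0 a 0 w w
  where
  w = ones-vs-ones-even (¬odd⇒even a (λ odd-a → ¬𝒫 (refl , refl , odd-a , odd-a)))
                        (subst (0 <_) (+-identityʳ a) 0<a+0)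

proposition3p4 : (a b c d : ℕ) → a + b ≡ c + d → 0 < a + b →
    ((b ≡ 0 × d ≡ 0 × Odd a × Odd c) → HasOutcome 2 ((1 ^^ a) ++ (2 ^^ b)) ((1 ^^ c) ++ (2 ^^ d)) 𝒫)
    × ((b ≡ 0 × d ≢ 0 × Odd c) → HasOutcome 2 ((1 ^^ a) ++ (2 ^^ b)) ((1 ^^ c) ++ (2 ^^ d)) 𝓛)
    × ((d ≡ 0 × b ≢ 0 × Odd a) → HasOutcome 2 ((1 ^^ a) ++ (2 ^^ b)) ((1 ^^ c) ++ (2 ^^ d)) 𝓡)
    × (¬ (b ≡ 0 × d ≡ 0 × Odd a × Odd c) → ¬ (b ≡ 0 × d ≢ 0 × Odd c) → ¬ (d ≡ 0 × b ≢ 0 × Odd a)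
       → HasOutcome 2 ((1 ^^ a) ++ (2 ^^ b)) ((1 ^^ c) ++ (2 ^^ d)) 𝒩)
proposition3p4 a b c d eq pos =
  outcome-𝒫 a b c d eq , outcome-𝓛 a b c d eq , outcome-𝓡 a b c d eq , outcome-𝒩 a b c d eq pos
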